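{- For every sequent $S = (\Gamma \Rightarrow \Delta)$: $\mathsf{IL} \vdash \bigwedge\Gamma \to \bigvee\Delta$ if and only if $S$ is provable in $\mathsf{G}^{\mathrm{fin}} + \mathrm{Cut}$.
   Context: Formulas: $\phi ::= p \mid \bot \mid \phi\to\phi \mid \phi\rhd\phi$ ($p$ propositional variables). Abbreviations $\neg\phi := \phi\to\bot$, $\phi\vee\psi := \neg\phi\to\psi$, $\phi\wedge\psi := \neg(\phi\to\neg\psi)$, $\Box\phi := \neg\phi\rhd\bot$, $\Diamond\phi := \neg(\phi\rhd\bot)$. $\mathsf{IL}$ is the smallest set of formulas containing all classical propositional tautologies and all instances of (K) $\Box(\phi\to\psi)\to(\Box\phi\to\Box\psi)$, (4) $\Box\phi\to\Box\Box\phi$, (L) $\Box(\Box\phi\to\phi)\to\Box\phi$, (J1) $\Box(\phi\to\psi)\to(\phi\rhd\psi)$, (J2) $(\phi\rhd\chi)\wedge(\chi\rhd\psi)\to(\phi\rhd\psi)$, (J3) $(\phi\rhd\psi)\wedge(\chi\rhd\psi)\to((\phi\vee\chi)\rhd\psi)$, (J4) $\phi\rhd\psi\to(\Diamond\phi\to\Diamond\psi)$, (J5) $\Diamond\phi\rhd\phi$, closed under modus ponens and necessitation. A sequent $\Gamma\Rightarrow\Delta$ is a pair of finite multisets of formulas (empty conjunction is $\top$, empty disjunction $\bot$); commas denote multiset union; $\Sigma\rhd\bot := \{\sigma\rhd\bot : \sigma\in\Sigma\}$; for formulas $\phi_0,\dots,\phi_{m-1}$, $\Phi_{[0,i)}$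 denotes the multiset $\{\phi_0,\dots,\phi_{i-1}\}$. Rules: (ax) $p,\Gamma\Rightarrow p,\Delta$ for a variable $p$; ($\bot$L) $\bot,\Gamma\Rightarrow\Delta$; ($\bot$R) from $\Gamma\Rightarrow\Delta$ infer $\Gamma\Rightarrow\bot,\Delta$; ($\to$L) from $\Gamma\Rightarrow\Delta,\phi$ and $\psi,\Gamma\Rightarrow\Delta$ infer $\phi\to\psi,\Gamma\Rightarrow\Delta$; ($\to$R) from $\phi,\Gamma\Rightarrow\Delta,\psi$ infer $\Gamma\Rightarrow\Delta,\phi\to\psi$; ($\rhd_{\mathsf{IL}}$) for any $m\ge 0$, formulas $\phi_0,\dots,\phi_{m-1},\psi_0,\dots,\psi_m,\phi$ and multisets $\Gamma,\Delta$: from the $m+1$ premises $\psi_i, (\psi_i,\Phi_{[0,i)},\phi)\rhd\bot \Rightarrow \Phi_{[0,i)},\phi$ ($i=0,\dots,m$) infer $\phi_0\rhd\psi_0,\dots,\phi_{m-1}\rhd\psi_{m-1},\Gamma\Rightarrow\psi_m\rhd\phi,\Delta$; (Cut) from $\Gamma\Rightarrow\Delta,\chi$ and $\chi,\Gamma\Rightarrow\Delta$ infer $\Gamma\Rightarrow\Delta$. $\mathsf{G}^{\mathrm{fin}}$ is the ordinary (finite-tree) sequent calculus with rules ax, $\bot$L, $\bot$R, $\to$L, $\to$R, $\rhd_{\mathsf{IL}}$; $\mathsf{G}^{\mathrm{fin}}+\mathrm{Cut}$ adds Cut. -}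

module Defs where

open import Data.Nat using (ℕ; zero; suc)
open import Data.Bool using (Bool; true; false; not; _∨_)
open import Data.List using (List; []; _∷_; _++_; map; take; [_])
open import Data.Vec using (Vec; toList; lookup; zipWith; _∷ʳ_)
open import Data.Fin using (Fin; toℕ)
open import Data.List.Relation.Binary.Permutation.Propositional using (_↭_)
open import Relation.Binary.PropositionalEquality using (_≡_)

infixr 6 _⇒_
infix 7 _▷_

data Fm : Set where
  var : ℕ → Fm
  ⊥′  : Fm
  _⇒_ : Fm → Fm → Fm
  _▷_ : Fm → Fm → Fm

¬′ : Fm → Fm
¬′ φ = φ ⇒ ⊥′

⊤′ : Fm
⊤′ = ¬′ ⊥′

_∨′_ : Fm → Fm → Fm
φ ∨′ ψ = ¬′ φ ⇒ ψ

_∧′_ : Fm → Fm → Fm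
φ ∧′ ψ = ¬′ (φ ⇒ ¬′ ψ)

□ : Fm → Fm
□ φ = ¬′ φ ▷ ⊥′

◇ : Fm → Fm
◇ φ = ¬′ (φ ▷ ⊥′)

⋀ : List Fm → Fm
⋀ []       = ⊤′
⋀ (φ ∷ Γ)  = φ ∧′ ⋀ Γ

⋁ : List Fm → Fm
⋁ []       = ⊥′
⋁ (φ ∷ Δ)  = φ ∨′ ⋁ Δ

-- Classical tautologies: true under every Boolean valuation in which
-- variables and ▷-formulas are treated as atoms (this covers exactly the
-- substitution instances of propositional tautologies).
eval : (ℕ → Bool) → (Fm → Fm → Bool) → Fm → Bool
eval v w (var p)  = v p
eval v w ⊥′       = false
eval v w (φ ⇒ ψ)  = not (eval v w φ) ∨ eval v w ψ
eval v w (φ ▷ ψ)  = w φ ψ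

Taut : Fm → Set
Taut φ = ∀ (v : ℕ → Bool) (w : Fm → Fm → Bool) → eval v w φ ≡ true

data IL⊢ : Fm → Set where
  taut : ∀ {φ} → Taut φ → IL⊢ φ
  axK  : ∀ φ ψ → IL⊢ (□ (φ ⇒ ψ) ⇒ (□ φ ⇒ □ ψ))
  ax4  : ∀ φ → IL⊢ (□ φ ⇒ □ (□ φ))
  axL  : ∀ φ → IL⊢ (□ (□ φ ⇒ φ) ⇒ □ φ)
  axJ1 : ∀ φ ψ → IL⊢ (□ (φ ⇒ ψ) ⇒ (φ ▷ ψ))
  axJ2 : ∀ φ χ ψ → IL⊢ (((φ ▷ χ) ∧′ (χ ▷ ψ)) ⇒ (φ ▷ ψ))
  axJ3 : ∀ φ χ ψ → IL⊢ (((φ ▷ ψ) ∧′ (χ ▷ ψ)) ⇒ ((φ ∨′ χ) ▷ ψ))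
  axJ4 : ∀ φ ψ → IL⊢ ((φ ▷ ψ) ⇒ (◇ φ ⇒ ◇ ψ))
  axJ5 : ∀ φ → IL⊢ (◇ φ ▷ φ)
  mp   : ∀ {φ ψ} → IL⊢ (φ ⇒ ψ) → IL⊢ φ → IL⊢ ψ
  nec  : ∀ {φ} → IL⊢ φ → IL⊢ (□ φ)

-- Sequents Γ ⇒ Δ: pairs of finite multisets, represented as lists; every
-- rule's conclusion may be any rearrangement (permutation) of the displayed
-- lists, so derivability only depends on the underlying multisets.
_▷⊥ : List Fm → List Fm
Σ ▷⊥ = map (λ σ → σ ▷ ⊥′) Σ

-- Premise i of the ▷_IL rule: ψ_i , (ψ_i , Φ_[0,i) , φ) ▷ ⊥ ⇒ Φ_[0,i) , φ
module _ {m : ℕ} (φs : Vec Fm m) (ψs : Vec Fm (suc m)) (φ : Fm) (i : Fin (suc m)) where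
  Φ< : List Fm
  Φ< = take (toℕ i) (toList φs)

  ▷prem-ant : List Fm
  ▷prem-ant = lookup ψs i ∷ ((lookup ψs i ∷ Φ< ++ [ φ ]) ▷⊥)

  ▷prem-suc : List Fm
  ▷prem-suc = Φ< ++ [ φ ]

data G : Bool → List Fm → List Fm → Set where
  ax   : ∀ {c Γ Δ Γ₀ Δ₀} p → Γ₀ ↭ (var p ∷ Γ) → Δ₀ ↭ (var p ∷ Δ) → G c Γ₀ Δ₀
  ⊥L   : ∀ {c Γ Δ Γ₀} → Γ₀ ↭ (⊥′ ∷ Γ) → G c Γ₀ Δ
  ⊥R   : ∀ {c Γ Δ Δ₀} → Δ₀ ↭ (⊥′ ∷ Δ) → G c Γ Δ → G c Γ Δ₀
  ⇒L   : ∀ {c Γ Δ Γ₀} φ ψ → Γ₀ ↭ ((φ ⇒ ψ) ∷ Γ) →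
         G c Γ (Δ ++ [ φ ]) → G c (ψ ∷ Γ) Δ → G c Γ₀ Δ
  ⇒R   : ∀ {c Γ Δ Δ₀} φ ψ → Δ₀ ↭ (Δ ++ [ φ ⇒ ψ ]) →
         G c (φ ∷ Γ) (Δ ++ [ ψ ]) → G c Γ Δ₀
  ▷IL  : ∀ {c Γ Δ Γ₀ Δ₀} (m : ℕ) (φs : Vec Fm m) (ψs : Vec Fm m) (ψm φ : Fm) →
         Γ₀ ↭ (toList (zipWith _▷_ φs ψs) ++ Γ) →
         Δ₀ ↭ ((ψm ▷ φ) ∷ Δ) →
         (∀ (i : Fin (suc m)) →
            G c (▷prem-ant φs (ψs ∷ʳ ψm) φ i) (▷prem-suc φs (ψs ∷ʳ ψm) φ i)) →
         G c Γ₀ Δ₀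
  cut  : ∀ {Γ Δ} χ → G true Γ (Δ ++ [ χ ]) → G true (χ ∷ Γ) Δ → G true Γ Δ

G+Cut⊢ : List Fm → List Fm → Set
G+Cut⊢ Γ Δ = G true Γ Δ

{-# OPTIONS --safe #-}
-- Soundness: every rule except ▷IL preserves Boolean truth of the sequent
-- formula (▷-formulas read as atoms), and IL is closed under tautological
-- consequence.  For ▷IL, Löb's axiom gives ψ ▷ ψ ∧ □¬ψ; under □¬ψ premise i
-- yields Φ_[0,i) ∨ φ unless ◇(Φ_[0,i) ∨ φ), which J5 absorbs, so
-- ψ_i ▷ Φ_[0,i) ∨ φ.  Composing with the antecedents φ_j ▷ ψ_j in order of j
-- (J2, J3) gives ψ_m ▷ φ.
-- Completeness: cut-free G already derives every Boolean-valid sequent; each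
-- IL axiom is a ▷IL instance with Boolean-valid premises, and modus ponens and
-- necessitation are simulated by Cut and by ▷IL with m = 0.
module Submission where

open import Defs
open import Data.Bool using (Bool; true; false; not; _∨_; T)
open import Data.Bool.Properties using (T-≡)
open import Data.Empty using (⊥-elim)
open import Data.Fin using (toℕ; zero; suc)
open import Data.List using (List; []; _∷_; _++_; [_]; take)
open import Data.List.Properties using (++-assoc; ++-identityʳ)
open import Data.List.Membership.Propositional using (_∈_; _∉_; find; lose)
open import Data.List.Membership.Propositional.Properties using (∈-∃++)
open import Data.List.Relation.Unary.All using (All; []; _∷_)
import Data.List.Relation.Unary.All as All
import Data.List.Relation.Unary.All.Properties as All
open import Data.List.Relation.Unary.Any using (Any; here; there)
import Data.List.Relation.Unary.Any.Properties as Any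
open import Data.List.Relation.Binary.Permutation.Propositional
  using (_↭_; ↭-refl; ↭-sym; ↭-trans; ↭-reflexive; prep; swap)
open import Data.List.Relation.Binary.Permutation.Propositional.Properties
  using (All-resp-↭; Any-resp-↭; shift; ∷↭∷ʳ; ++⁺ˡ; ++⁺ʳ)
open import Data.Nat using (ℕ)
import Data.Nat as ℕ
open import Data.Product using (_×_; _,_; proj₂; ∃)
open import Data.Sum using (inj₁; inj₂)
open import Data.Unit using (tt)
open import Data.Vec using (Vec; []; _∷_; toList; lookup; zipWith; _∷ʳ_)
open import Function using (_∘_; id; const)
open import Function.Bundles using (_⇔_; mk⇔; Equivalence)
open import Relation.Binary.Definitions using (DecidableEquality)
open import Relation.Binary.PropositionalEquality using (refl; sym; cong; cong₂; subst; subst₂)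
open import Relation.Nullary using (Dec; yes; no; ¬_)
open import Relation.Nullary.Decidable
  using (map′; _×-dec_; isYes; toWitness; fromWitness; decidable-stable; T?)

-- Boolean semantics, with ▷-formulas as atoms

record Valuation : Set where
  field
    varᵛ : ℕ → Bool
    ▷ᵛ   : Fm → Fm → Bool
open Valuation

⟦_⟧ : Fm → Valuation → Bool
⟦ φ ⟧ ρ = eval (varᵛ ρ) (▷ᵛ ρ) φ

infix 4 _⊨_ _⊨_⟹_

record _⊨_ (ρ : Valuation) (φ : Fm) : Set where
  constructor holds
  field truth : T (⟦ φ ⟧ ρ)
open _⊨_

T-not-∨ : ∀ x {y} → T (not x ∨ y) ⇔ (T x → T y)
T-not-∨ true  = mk⇔ const (λ f → f tt)
T-not-∨ false = mk⇔ (λ _ ()) (const tt)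

module _ {ρ : Valuation} where

  ⊭⊥ : ¬ ρ ⊨ ⊥′
  ⊭⊥ (holds ())

  ⊨⇒-intro : ∀ {a b} → (ρ ⊨ a → ρ ⊨ b) → ρ ⊨ a ⇒ b
  ⊨⇒-intro {a} f = holds (Equivalence.from (T-not-∨ (⟦ a ⟧ ρ)) (truth ∘ f ∘ holds))

  ⊨⇒-elim : ∀ {a b} → ρ ⊨ a ⇒ b → ρ ⊨ a → ρ ⊨ b
  ⊨⇒-elim {a} (holds f) (holds x) = holds (Equivalence.to (T-not-∨ (⟦ a ⟧ ρ)) f x)

  _⊨? : ∀ φ → Dec (ρ ⊨ φ)
  φ ⊨? = map′ holds truth (T? (⟦ φ ⟧ ρ))

  ⊨-stable : ∀ {a} → ¬ ¬ ρ ⊨ a → ρ ⊨ a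
  ⊨-stable {a} = decidable-stable (a ⊨?)

  ⊨¬-intro : ∀ {a} → ¬ ρ ⊨ a → ρ ⊨ ¬′ a
  ⊨¬-intro n = ⊨⇒-intro (⊥-elim ∘ n)

  ⊨¬-elim : ∀ {a} → ρ ⊨ ¬′ a → ¬ ρ ⊨ a
  ⊨¬-elim h = ⊭⊥ ∘ ⊨⇒-elim h

  ⊨∧-intro : ∀ {a b} → ρ ⊨ a → ρ ⊨ b → ρ ⊨ a ∧′ b
  ⊨∧-intro x y = ⊨¬-intro λ h → ⊨¬-elim (⊨⇒-elim h x) y

  ⊨¬⇒-elim : ∀ {a b} → ρ ⊨ ¬′ (a ⇒ b) → ρ ⊨ a × ¬ ρ ⊨ b
  ⊨¬⇒-elim h = ⊨-stable (λ na → ⊨¬-elim h (⊨⇒-intro (⊥-elim ∘ na)))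
             , (λ y → ⊨¬-elim h (⊨⇒-intro (const y)))

  ⊨∧-elim : ∀ {a b} → ρ ⊨ a ∧′ b → ρ ⊨ a × ρ ⊨ b
  ⊨∧-elim h = let x , n¬y = ⊨¬⇒-elim h in x , ⊨-stable (n¬y ∘ ⊨¬-intro)

  ⊨∨-inj₁ : ∀ {a b} → ρ ⊨ a → ρ ⊨ a ∨′ b
  ⊨∨-inj₁ x = ⊨⇒-intro λ nx → ⊥-elim (⊨¬-elim nx x)

  ⊨∨-inj₂ : ∀ {a b} → ρ ⊨ b → ρ ⊨ a ∨′ b
  ⊨∨-inj₂ y = ⊨⇒-intro (const y)

  ⊨⋀-intro : ∀ {Γ} → All (ρ ⊨_) Γ → ρ ⊨ ⋀ Γ
  ⊨⋀-intro []       = ⊨¬-intro ⊭⊥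
  ⊨⋀-intro (x ∷ xs) = ⊨∧-intro x (⊨⋀-intro xs)

  ⊨⋀-elim : ∀ {Γ} → ρ ⊨ ⋀ Γ → All (ρ ⊨_) Γ
  ⊨⋀-elim {[]}    _ = []
  ⊨⋀-elim {_ ∷ Γ} h = let x , xs = ⊨∧-elim h in x ∷ ⊨⋀-elim xs

  ⊨⋁-intro : ∀ {Δ} → Any (ρ ⊨_) Δ → ρ ⊨ ⋁ Δ
  ⊨⋁-intro (here x)  = ⊨∨-inj₁ x
  ⊨⋁-intro (there δ) = ⊨∨-inj₂ (⊨⋁-intro δ)

  ⊨⋁-elim : ∀ {Δ} → ρ ⊨ ⋁ Δ → Any (ρ ⊨_) Δ
  ⊨⋁-elim {[]}    h = ⊥-elim (⊭⊥ h)
  ⊨⋁-elim {φ ∷ Δ} h with φ ⊨?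
  ... | yes x = here x
  ... | no nx = there (⊨⋁-elim (⊨⇒-elim h (⊨¬-intro nx)))

_⊨_⟹_ : Valuation → List Fm → List Fm → Set
ρ ⊨ Γ ⟹ Δ = All (ρ ⊨_) Γ → Any (ρ ⊨_) Δ

Valid : List Fm → List Fm → Set
Valid Γ Δ = ∀ ρ → ρ ⊨ Γ ⟹ Δ

module _ {ρ : Valuation} {Γ Δ : List Fm} where

  ⊨⋀⇒⋁-intro : ρ ⊨ Γ ⟹ Δ → ρ ⊨ ⋀ Γ ⇒ ⋁ Δ
  ⊨⋀⇒⋁-intro h = ⊨⇒-intro (⊨⋁-intro ∘ h ∘ ⊨⋀-elim)

  ⊨⋀⇒⋁-elim : ρ ⊨ ⋀ Γ ⇒ ⋁ Δ → ρ ⊨ Γ ⟹ Δ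
  ⊨⋀⇒⋁-elim h = ⊨⋁-elim ∘ ⊨⇒-elim h ∘ ⊨⋀-intro

  ⊨⟹-resp-↭ : ∀ {Γ′ Δ′} → Γ ↭ Γ′ → Δ ↭ Δ′ → ρ ⊨ Γ ⟹ Δ → ρ ⊨ Γ′ ⟹ Δ′
  ⊨⟹-resp-↭ Γ↭ Δ↭ h = Any-resp-↭ Δ↭ ∘ h ∘ All-resp-↭ (↭-sym Γ↭)

Valid-resp-↭ : ∀ {Γ Δ Γ′ Δ′} → Γ ↭ Γ′ → Δ ↭ Δ′ → Valid Γ Δ → Valid Γ′ Δ′
Valid-resp-↭ Γ↭ Δ↭ V ρ = ⊨⟹-resp-↭ Γ↭ Δ↭ (V ρ)

tautology : ∀ {φ} → (∀ ρ → ρ ⊨ φ) → IL⊢ φ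
tautology f = taut λ v w → Equivalence.to T-≡ (truth (f record { varᵛ = v ; ▷ᵛ = w }))

by-taut : ∀ {Xs φ} → All IL⊢ Xs → (∀ ρ → All (ρ ⊨_) Xs → ρ ⊨ φ) → IL⊢ φ
by-taut []       f = tautology λ ρ → f ρ []
by-taut (p ∷ ps) f = mp (by-taut ps λ ρ xs → ⊨⇒-intro λ x → f ρ (x ∷ xs)) p

infix 4 _⊢_

_⊢_ : Fm → Fm → Set
H ⊢ φ = IL⊢ (H ⇒ φ)

⊢-by-taut : ∀ {H Xs φ} → All (H ⊢_) Xs → (∀ ρ → All (ρ ⊨_) Xs → ρ ⊨ φ) → H ⊢ φ
⊢-by-taut []       f = tautology λ ρ → ⊨⇒-intro λ _ → f ρ []
⊢-by-taut (p ∷ ps) f =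
  by-taut (p ∷ ⊢-by-taut ps (λ ρ xs → ⊨⇒-intro λ x → f ρ (x ∷ xs)) ∷ [])
    λ { ρ (x ∷ x⇒φ ∷ []) → ⊨⇒-intro λ h → ⊨⇒-elim (⊨⇒-elim x⇒φ h) (⊨⇒-elim x h) }

weaken : ∀ {H φ} → IL⊢ φ → H ⊢ φ
weaken p = by-taut (p ∷ []) λ { ρ (x ∷ []) → ⊨⇒-intro (const x) }

assumption : ∀ {H} → H ⊢ H
assumption = tautology λ ρ → ⊨⇒-intro id

⊢-⋀ : ∀ {H Xs} → All (H ⊢_) Xs → H ⊢ ⋀ Xs
⊢-⋀ ps = ⊢-by-taut ps λ ρ → ⊨⋀-intro

⋀-members : ∀ Γ → All (⋀ Γ ⊢_) Γ
⋀-members Γ = All.tabulate λ x∈Γ → tautology λ ρ → ⊨⇒-intro λ h → All.lookup (⊨⋀-elim h) x∈Γ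

⇒-to-▷ : ∀ {a b} → IL⊢ (a ⇒ b) → IL⊢ (a ▷ b)
⇒-to-▷ {a} {b} p = mp (axJ1 a b) (nec p)

▷-refl : ∀ {a} → IL⊢ (a ▷ a)
▷-refl = ⇒-to-▷ (tautology λ ρ → ⊨⇒-intro id)

▷-trans : ∀ {H a b c} → H ⊢ a ▷ b → H ⊢ b ▷ c → H ⊢ a ▷ c
▷-trans {a = a} {b} {c} p q = ⊢-by-taut (p ∷ q ∷ weaken (axJ2 a b c) ∷ [])
  λ { ρ (ab ∷ bc ∷ j2 ∷ []) → ⊨⇒-elim j2 (⊨∧-intro ab bc) }

▷-∨ : ∀ {H a b c} → H ⊢ a ▷ c → H ⊢ b ▷ c → H ⊢ (a ∨′ b) ▷ c
▷-∨ {a = a} {b} {c} p q = ⊢-by-taut (p ∷ q ∷ weaken (axJ3 a b c) ∷ [])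
  λ { ρ (ac ∷ bc ∷ j3 ∷ []) → ⊨⇒-elim j3 (⊨∧-intro ac bc) }

▷-⋁ : ∀ {H c} {L : List Fm} → All (λ x → H ⊢ x ▷ c) L → H ⊢ ⋁ L ▷ c
▷-⋁ []       = weaken (⇒-to-▷ (tautology λ ρ → ⊨⇒-intro (⊥-elim ∘ ⊭⊥)))
▷-⋁ (p ∷ ps) = ▷-∨ p (▷-⋁ ps)

▷-antitoneˡ : ∀ {a b c} → IL⊢ (a ⇒ b) → b ▷ c ⊢ a ▷ c
▷-antitoneˡ p = ▷-trans (weaken (⇒-to-▷ p)) assumption

∨◇-▷ : ∀ {H a} → H ⊢ (a ∨′ ◇ a) ▷ a
∨◇-▷ {a = a} = ▷-∨ (weaken ▷-refl) (weaken (axJ5 a))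

löb-▷ : ∀ ψ → (ψ ∧′ (ψ ▷ ⊥′)) ▷ ⊥′ ⊢ ψ ▷ ⊥′
löb-▷ ψ = ⊢-by-taut (weaken (axL (¬′ ψ)) ∷ □-premise ∷ weaken □¬ψ⇒ψ▷⊥ ∷ [])
  λ { ρ (löb ∷ p ∷ q ∷ []) → ⊨⇒-elim q (⊨⇒-elim löb p) }
  where
  □¬ψ⇒ψ▷⊥ : IL⊢ (□ (¬′ ψ) ⇒ ψ ▷ ⊥′)
  □¬ψ⇒ψ▷⊥ = ▷-antitoneˡ (tautology λ ρ → ⊨⇒-intro λ x → ⊨¬-intro (λ nx → ⊨¬-elim nx x))

  □-premise : (ψ ∧′ (ψ ▷ ⊥′)) ▷ ⊥′ ⊢ □ (□ (¬′ ψ) ⇒ ¬′ ψ)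
  □-premise = ▷-antitoneˡ (by-taut (□¬ψ⇒ψ▷⊥ ∷ []) λ { ρ (q ∷ []) → ⊨⇒-intro λ h →
    let □¬ψ , ¬¬ψ = ⊨¬⇒-elim h in ⊨∧-intro (⊨-stable (¬¬ψ ∘ ⊨¬-intro)) (⊨⇒-elim q □¬ψ) })

▷-maximal : ∀ {H} ψ → H ⊢ ψ ▷ (ψ ∧′ (ψ ▷ ⊥′))
▷-maximal ψ =
  ▷-trans (weaken (⇒-to-▷ (by-taut (löb-▷ ψ ∷ []) λ { ρ (löb ∷ []) → ⊨⇒-intro (split löb) }))) ∨◇-▷
  where
  X : Fm
  X = ψ ∧′ (ψ ▷ ⊥′)

  split : ∀ {ρ} → ρ ⊨ X ▷ ⊥′ ⇒ ψ ▷ ⊥′ → ρ ⊨ ψ → ρ ⊨ X ∨′ ◇ X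
  split {ρ} löb x with (ψ ▷ ⊥′) ⊨?
  ... | yes b = ⊨∨-inj₁ (⊨∧-intro x b)
  ... | no nb = ⊨∨-inj₂ (⊨¬-intro (nb ∘ ⊨⇒-elim löb))

⋁▷⊥-⋀ : ∀ L → ⋁ L ▷ ⊥′ ⊢ ⋀ (L ▷⊥)
⋁▷⊥-⋀ L = ⊢-⋀ (All.map⁺ (All.tabulate λ x∈L →
  ▷-antitoneˡ (tautology λ ρ → ⊨⇒-intro (⊨⋁-intro ∘ lose x∈L))))

premise-▷ : ∀ {H ψ L} → IL⊢ (⋀ (ψ ∷ (ψ ∷ L) ▷⊥) ⇒ ⋁ L) → H ⊢ ψ ▷ ⋁ L
premise-▷ {ψ = ψ} {L} P =
  ▷-trans (▷-maximal ψ)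
    (▷-trans (weaken (⇒-to-▷ (by-taut (P ∷ ⋁▷⊥-⋀ L ∷ [])
               λ { ρ (p ∷ q ∷ []) → ⊨⇒-intro (split p q) })))
             ∨◇-▷)
  where
  split : ∀ {ρ} → ρ ⊨ ⋀ (ψ ∷ (ψ ∷ L) ▷⊥) ⇒ ⋁ L → ρ ⊨ ⋁ L ▷ ⊥′ ⇒ ⋀ (L ▷⊥) →
          ρ ⊨ ψ ∧′ (ψ ▷ ⊥′) → ρ ⊨ ⋁ L ∨′ ◇ (⋁ L)
  split {ρ} p q x with (⋁ L ▷ ⊥′) ⊨?
  ... | yes b = let y , ψ▷⊥ = ⊨∧-elim x
                in  ⊨∨-inj₁ (⊨⇒-elim p (⊨⋀-intro (y ∷ ψ▷⊥ ∷ ⊨⋀-elim (⊨⇒-elim q b))))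
  ... | no nb = ⊨∨-inj₂ (⊨¬-intro nb)

▷-collapse : ∀ {H b φ} {done : List Fm} →
             All (λ x → H ⊢ x ▷ φ) done → H ⊢ b ▷ ⋁ (done ++ [ φ ]) → H ⊢ b ▷ φ
▷-collapse done▷φ b▷ = ▷-trans b▷ (▷-⋁ (All.++⁺ done▷φ (weaken ▷-refl ∷ [])))

-- With x ▷ φ known for every x in done, J3 collapses premise i to ψ_i ▷ φ,
-- and then φ_i ▷ ψ_i lets φ_i join done.
▷-chain : ∀ {H n} (done : List Fm) (φs ψs : Vec Fm n) ψ φ →
          All (λ x → H ⊢ x ▷ φ) done →
          All (H ⊢_) (toList (zipWith _▷_ φs ψs)) →
          (∀ i → H ⊢ lookup (ψs ∷ʳ ψ) i ▷ ⋁ (done ++ take (toℕ i) (toList φs) ++ [ φ ])) →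
          H ⊢ ψ ▷ φ
▷-chain done []       []       ψ φ done▷φ []           reach = ▷-collapse done▷φ (reach zero)
▷-chain done (a ∷ φs) (b ∷ ψs) ψ φ done▷φ (a▷b ∷ a▷bs) reach =
  ▷-chain (done ++ [ a ]) φs ψs ψ φ
    (All.++⁺ done▷φ (▷-trans a▷b (▷-collapse done▷φ (reach zero)) ∷ [])) a▷bs
    λ i → subst (λ Φ → _ ⊢ _ ▷ ⋁ Φ) (sym (++-assoc done [ a ] _)) (reach (suc i))

▷IL-sound : ∀ {m} (φs ψs : Vec Fm m) ψ φ →
  (∀ i → IL⊢ (⋀ (▷prem-ant φs (ψs ∷ʳ ψ) φ i) ⇒ ⋁ (▷prem-suc φs (ψs ∷ʳ ψ) φ i))) →
  ⋀ (toList (zipWith _▷_ φs ψs)) ⊢ ψ ▷ φ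
▷IL-sound φs ψs ψ φ premises = ▷-chain [] φs ψs ψ φ [] (⋀-members _) (premise-▷ ∘ premises)

-- Soundness

module _ {ρ : Valuation} {Γ Δ : List Fm} where

  ⇒L-sound : ∀ {φ ψ} → ρ ⊨ Γ ⟹ Δ ++ [ φ ] → ρ ⊨ ψ ∷ Γ ⟹ Δ → ρ ⊨ (φ ⇒ ψ) ∷ Γ ⟹ Δ
  ⇒L-sound h₁ h₂ (φ⇒ψ ∷ γ) with Any.++⁻ Δ (h₁ γ)
  ... | inj₁ δ        = δ
  ... | inj₂ (here x) = h₂ (⊨⇒-elim φ⇒ψ x ∷ γ)

  ⇒R-sound : ∀ {φ ψ} → ρ ⊨ φ ∷ Γ ⟹ Δ ++ [ ψ ] → ρ ⊨ Γ ⟹ Δ ++ [ φ ⇒ ψ ]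
  ⇒R-sound {φ} h γ with φ ⊨?
  ... | no nx = Any.++⁺ʳ Δ (here (⊨⇒-intro (⊥-elim ∘ nx)))
  ... | yes x with Any.++⁻ Δ (h (x ∷ γ))
  ...   | inj₁ δ        = Any.++⁺ˡ δ
  ...   | inj₂ (here y) = Any.++⁺ʳ Δ (here (⊨⇒-intro (const y)))

  cut-sound : ∀ {χ} → ρ ⊨ Γ ⟹ Δ ++ [ χ ] → ρ ⊨ χ ∷ Γ ⟹ Δ → ρ ⊨ Γ ⟹ Δ
  cut-sound h₁ h₂ γ with Any.++⁻ Δ (h₁ γ)
  ... | inj₁ δ        = δ
  ... | inj₂ (here x) = h₂ (x ∷ γ)

valid-sequent : ∀ {Γ Δ} → Valid Γ Δ → IL⊢ (⋀ Γ ⇒ ⋁ Δ)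
valid-sequent V = tautology (⊨⋀⇒⋁-intro ∘ V)

mutual
  sound : ∀ {c Γ Δ} → G c Γ Δ → IL⊢ (⋀ Γ ⇒ ⋁ Δ)
  sound (ax p Γ↭ Δ↭)  = valid-sequent (Valid-resp-↭ (↭-sym Γ↭) (↭-sym Δ↭) λ { ρ (x ∷ _) → here x })
  sound (⊥L Γ↭)       = valid-sequent (Valid-resp-↭ (↭-sym Γ↭) ↭-refl λ { ρ (x ∷ _) → ⊥-elim (⊭⊥ x) })
  sound (⊥R Δ↭ s)     = sound-rule₁ s λ h → ⊨⟹-resp-↭ ↭-refl (↭-sym Δ↭) (there ∘ h)
  sound (⇒L φ ψ Γ↭ s₁ s₂) = sound-rule₂ s₁ s₂ λ h₁ h₂ → ⊨⟹-resp-↭ (↭-sym Γ↭) ↭-refl (⇒L-sound h₁ h₂)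
  sound (⇒R φ ψ Δ↭ s) = sound-rule₁ s λ h → ⊨⟹-resp-↭ ↭-refl (↭-sym Δ↭) (⇒R-sound h)
  sound (cut χ s₁ s₂) = sound-rule₂ s₁ s₂ cut-sound
  sound (▷IL m φs ψs ψ φ Γ↭ Δ↭ s) = by-taut (▷IL-sound φs ψs ψ φ (λ i → sound (s i)) ∷ [])
    λ { ρ (h ∷ []) → ⊨⋀⇒⋁-intro (⊨⟹-resp-↭ (↭-sym Γ↭) (↭-sym Δ↭)
          λ γ → here (⊨⇒-elim h (⊨⋀-intro (All.++⁻ˡ _ γ)))) }

  sound-rule₁ : ∀ {c Γ₁ Δ₁ Γ Δ} → G c Γ₁ Δ₁ →
                (∀ {ρ} → ρ ⊨ Γ₁ ⟹ Δ₁ → ρ ⊨ Γ ⟹ Δ) → IL⊢ (⋀ Γ ⇒ ⋁ Δ)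
  sound-rule₁ s f = by-taut (sound s ∷ []) λ { ρ (h ∷ []) → ⊨⋀⇒⋁-intro (f (⊨⋀⇒⋁-elim h)) }

  sound-rule₂ : ∀ {c Γ₁ Δ₁ Γ₂ Δ₂ Γ Δ} → G c Γ₁ Δ₁ → G c Γ₂ Δ₂ →
                (∀ {ρ} → ρ ⊨ Γ₁ ⟹ Δ₁ → ρ ⊨ Γ₂ ⟹ Δ₂ → ρ ⊨ Γ ⟹ Δ) → IL⊢ (⋀ Γ ⇒ ⋁ Δ)
  sound-rule₂ s₁ s₂ f = by-taut (sound s₁ ∷ sound s₂ ∷ [])
    λ { ρ (h₁ ∷ h₂ ∷ []) → ⊨⋀⇒⋁-intro (f (⊨⋀⇒⋁-elim h₁) (⊨⋀⇒⋁-elim h₂)) }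

G-resp-↭ : ∀ {c Γ Δ Γ′ Δ′} → Γ ↭ Γ′ → Δ ↭ Δ′ → G c Γ Δ → G c Γ′ Δ′
G-resp-↭ Γ↭ Δ↭ (ax p g d)        = ax p (↭-trans (↭-sym Γ↭) g) (↭-trans (↭-sym Δ↭) d)
G-resp-↭ Γ↭ Δ↭ (⊥L g)            = ⊥L (↭-trans (↭-sym Γ↭) g)
G-resp-↭ Γ↭ Δ↭ (⊥R d s)          = ⊥R (↭-trans (↭-sym Δ↭) d) (G-resp-↭ Γ↭ ↭-refl s)
G-resp-↭ Γ↭ Δ↭ (⇒L φ ψ g s₁ s₂)  =
  ⇒L φ ψ (↭-trans (↭-sym Γ↭) g) (G-resp-↭ ↭-refl (++⁺ʳ [ φ ] Δ↭) s₁) (G-resp-↭ ↭-refl Δ↭ s₂)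
G-resp-↭ Γ↭ Δ↭ (⇒R φ ψ d s)      = ⇒R φ ψ (↭-trans (↭-sym Δ↭) d) (G-resp-↭ (prep φ Γ↭) ↭-refl s)
G-resp-↭ Γ↭ Δ↭ (▷IL m φs ψs ψ φ g d s) =
  ▷IL m φs ψs ψ φ (↭-trans (↭-sym Γ↭) g) (↭-trans (↭-sym Δ↭) d) s
G-resp-↭ Γ↭ Δ↭ (cut χ s₁ s₂)     =
  cut χ (G-resp-↭ Γ↭ (++⁺ʳ [ χ ] Δ↭) s₁) (G-resp-↭ (prep χ Γ↭) Δ↭ s₂)

∷ʳ-++-↭ : ∀ (xs ys : List Fm) x → (xs ++ [ x ]) ++ ys ↭ (xs ++ ys) ++ [ x ]
∷ʳ-++-↭ xs ys x = ↭-trans (↭-reflexive (++-assoc xs [ x ] ys))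
                 (↭-trans (++⁺ˡ xs (∷↭∷ʳ x ys)) (↭-reflexive (sym (++-assoc xs ys [ x ]))))

G-weaken : ∀ {c Γ Δ} Γ′ Δ′ → G c Γ Δ → G c (Γ ++ Γ′) (Δ ++ Δ′)
G-weaken Γ′ Δ′ (ax p g d) = ax p (++⁺ʳ Γ′ g) (++⁺ʳ Δ′ d)
G-weaken Γ′ Δ′ (⊥L g)     = ⊥L (++⁺ʳ Γ′ g)
G-weaken Γ′ Δ′ (⊥R d s)   = ⊥R (++⁺ʳ Δ′ d) (G-weaken Γ′ Δ′ s)
G-weaken Γ′ Δ′ (⇒L {Δ = Δ} φ ψ g s₁ s₂) =
  ⇒L φ ψ (++⁺ʳ Γ′ g) (G-resp-↭ ↭-refl (∷ʳ-++-↭ Δ Δ′ φ) (G-weaken Γ′ Δ′ s₁)) (G-weaken Γ′ Δ′ s₂)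
G-weaken Γ′ Δ′ (⇒R {Δ = Δ} φ ψ d s) =
  ⇒R φ ψ (↭-trans (++⁺ʳ Δ′ d) (∷ʳ-++-↭ Δ Δ′ (φ ⇒ ψ)))
    (G-resp-↭ ↭-refl (∷ʳ-++-↭ Δ Δ′ ψ) (G-weaken Γ′ Δ′ s))
G-weaken Γ′ Δ′ (▷IL {Γ = Γ} m φs ψs ψ φ g d s) =
  ▷IL m φs ψs ψ φ (↭-trans (++⁺ʳ Γ′ g) (↭-reflexive (++-assoc (toList (zipWith _▷_ φs ψs)) Γ Γ′)))
    (++⁺ʳ Δ′ d) s
G-weaken Γ′ Δ′ (cut {Δ = Δ} χ s₁ s₂) =
  cut χ (G-resp-↭ ↭-refl (∷ʳ-++-↭ Δ Δ′ χ) (G-weaken Γ′ Δ′ s₁)) (G-weaken Γ′ Δ′ s₂)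

G-id : ∀ {c} χ {Γ Δ} → G c (χ ∷ Γ) (χ ∷ Δ)
G-id (var p) = ax p ↭-refl ↭-refl
G-id ⊥′      = ⊥L ↭-refl
G-id (a ⇒ b) {Δ = Δ} =
  ⇒R a b (∷↭∷ʳ _ Δ)
    (⇒L a b (swap a (a ⇒ b) ↭-refl) (G-resp-↭ ↭-refl (∷↭∷ʳ a _) (G-id a))
                                     (G-resp-↭ ↭-refl (∷↭∷ʳ b Δ) (G-id b)))
G-id (a ▷ b) = ▷IL 1 (a ∷ []) (b ∷ []) a b ↭-refl ↭-refl λ { zero → G-id b ; (suc zero) → G-id a }

∈⇒↭ : ∀ {x : Fm} {xs} → x ∈ xs → ∃ λ ys → xs ↭ x ∷ ys
∈⇒↭ x∈xs with ys , zs , refl ← ∈-∃++ x∈xs = ys ++ zs , shift _ ys zs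

G-shared : ∀ {c x Γ Δ} → x ∈ Γ → x ∈ Δ → G c Γ Δ
G-shared x∈Γ x∈Δ = G-resp-↭ (↭-sym (proj₂ (∈⇒↭ x∈Γ))) (↭-sym (proj₂ (∈⇒↭ x∈Δ))) (G-id _)

-- Completeness of G for Boolean validity

_≟_ : DecidableEquality Fm
var p   ≟ var q   = map′ (cong var) (λ { refl → refl }) (p ℕ.≟ q)
⊥′      ≟ ⊥′      = yes refl
(a ⇒ b) ≟ (c ⇒ d) = map′ (λ (e , f) → cong₂ _⇒_ e f) (λ { refl → refl , refl }) (a ≟ c ×-dec b ≟ d)
(a ▷ b) ≟ (c ▷ d) = map′ (λ (e , f) → cong₂ _▷_ e f) (λ { refl → refl , refl }) (a ≟ c ×-dec b ≟ d)
var _   ≟ ⊥′      = no λ ()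
var _   ≟ (_ ⇒ _) = no λ ()
var _   ≟ (_ ▷ _) = no λ ()
⊥′      ≟ var _   = no λ ()
⊥′      ≟ (_ ⇒ _) = no λ ()
⊥′      ≟ (_ ▷ _) = no λ ()
(_ ⇒ _) ≟ var _   = no λ ()
(_ ⇒ _) ≟ ⊥′      = no λ ()
(_ ⇒ _) ≟ (_ ▷ _) = no λ ()
(_ ▷ _) ≟ var _   = no λ ()
(_ ▷ _) ≟ ⊥′      = no λ ()
(_ ▷ _) ≟ (_ ⇒ _) = no λ ()

open import Data.List.Membership.DecPropositional _≟_ using (_∈?_)

data Atom : Fm → Set where
  atom-var : ∀ p → Atom (var p)
  atom-⊥   : Atom ⊥′
  atom-▷   : ∀ a b → Atom (a ▷ b)

module Countermodel (Γ : List Fm) where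

  ρ : Valuation
  ρ = record { varᵛ = λ p → isYes (var p ∈? Γ) ; ▷ᵛ = λ a b → isYes ((a ▷ b) ∈? Γ) }

  ⊨⇒∈ : ∀ {x} → Atom x → ρ ⊨ x → x ∈ Γ
  ⊨⇒∈ (atom-var p) (holds t) = toWitness t
  ⊨⇒∈ atom-⊥       x         = ⊥-elim (⊭⊥ x)
  ⊨⇒∈ (atom-▷ a b) (holds t) = toWitness t

  ∈⇒⊨ : ∀ {x} → ⊥′ ∉ Γ → Atom x → x ∈ Γ → ρ ⊨ x
  ∈⇒⊨ _   (atom-var p) x∈Γ = holds (fromWitness x∈Γ)
  ∈⇒⊨ ⊥∉Γ atom-⊥       ⊥∈Γ = ⊥-elim (⊥∉Γ ⊥∈Γ)
  ∈⇒⊨ _   (atom-▷ a b) x∈Γ = holds (fromWitness x∈Γ)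

atomic-complete : ∀ {c Γ Δ} → All Atom Γ → All Atom Δ → Valid Γ Δ → G c Γ Δ
atomic-complete {Γ = Γ} atomsΓ atomsΔ V with ⊥′ ∈? Γ
... | yes ⊥∈Γ = ⊥L (proj₂ (∈⇒↭ ⊥∈Γ))
... | no ⊥∉Γ =
  let x , x∈Δ , ρ⊨x = find (V ρ (All.tabulate λ x∈Γ → ∈⇒⊨ ⊥∉Γ (All.lookup atomsΓ x∈Γ) x∈Γ))
  in  G-shared (⊨⇒∈ (All.lookup atomsΔ x∈Δ) ρ⊨x) x∈Δ
  where open Countermodel Γ

⇒L-invert₁ : ∀ {a b Γ Δ} → Valid ((a ⇒ b) ∷ Γ) Δ → Valid Γ (a ∷ Δ)
⇒L-invert₁ {a} V ρ γ with a ⊨?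
... | yes x = here x
... | no nx = there (V ρ (⊨⇒-intro (⊥-elim ∘ nx) ∷ γ))

⇒L-invert₂ : ∀ {a b Γ Δ} → Valid ((a ⇒ b) ∷ Γ) Δ → Valid (b ∷ Γ) Δ
⇒L-invert₂ V ρ (y ∷ γ) = V ρ (⊨⇒-intro (const y) ∷ γ)

⇒R-invert : ∀ {a b Γ Δ} → Valid Γ ((a ⇒ b) ∷ Δ) → Valid (a ∷ Γ) (b ∷ Δ)
⇒R-invert V ρ (x ∷ γ) with V ρ γ
... | here a⇒b = here (⊨⇒-elim a⇒b x)
... | there δ  = there δ

Complete : Bool → List Fm → List Fm → Set
Complete c Γ Δ = ∀ {Γa Δa} → All Atom Γa → All Atom Δa →
                 Valid (Γa ++ Γ) (Δa ++ Δ) → G c (Γa ++ Γ) (Δa ++ Δ)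

Complete-[] : ∀ {c} → Complete c [] []
Complete-[] {c} {Γa} {Δa} atomsΓ atomsΔ V =
  subst₂ (G c) (sym (++-identityʳ Γa)) (sym (++-identityʳ Δa))
    (atomic-complete atomsΓ atomsΔ (subst₂ Valid (++-identityʳ Γa) (++-identityʳ Δa) V))

Complete-++ : ∀ {c Γ Δ Γb Δb} → All Atom Γb → All Atom Δb →
              Complete c Γ Δ → Complete c (Γb ++ Γ) (Δb ++ Δ)
Complete-++ {c} {Γ} {Δ} {Γb} {Δb} atomsΓb atomsΔb k {Γa} {Δa} atomsΓa atomsΔa V =
  subst₂ (G c) (++-assoc Γa Γb Γ) (++-assoc Δa Δb Δ)
    (k (All.++⁺ atomsΓa atomsΓb) (All.++⁺ atomsΔa atomsΔb)
       (subst₂ Valid (sym (++-assoc Γa Γb Γ)) (sym (++-assoc Δa Δb Δ)) V))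

-- Structural recursion on χ: atoms are handed to the continuation k, which is
-- why Complete quantifies over all atomic extensions of the sequent.
mutual
  complete-left : ∀ {c Γ Δ} χ → Complete c Γ Δ → Valid (χ ∷ Γ) Δ → G c (χ ∷ Γ) Δ
  complete-left (var p) k = k (atom-var p ∷ []) []
  complete-left ⊥′      k = k (atom-⊥ ∷ []) []
  complete-left (a ▷ b) k = k (atom-▷ a b ∷ []) []
  complete-left (a ⇒ b) k V =
    ⇒L a b ↭-refl (G-resp-↭ ↭-refl (∷↭∷ʳ a _) (complete-right a k (⇒L-invert₁ V)))
                  (complete-left b k (⇒L-invert₂ V))

  complete-right : ∀ {c Γ Δ} χ → Complete c Γ Δ → Valid Γ (χ ∷ Δ) → G c Γ (χ ∷ Δ)
  complete-right (var p) k = k [] (atom-var p ∷ [])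
  complete-right ⊥′      k = k [] (atom-⊥ ∷ [])
  complete-right (a ▷ b) k = k [] (atom-▷ a b ∷ [])
  complete-right (a ⇒ b) k V =
    ⇒R a b (∷↭∷ʳ _ _) (G-resp-↭ ↭-refl (∷↭∷ʳ b _) (complete-left a (Complete-∷ʳ b k) (⇒R-invert V)))

  Complete-∷ʳ : ∀ {c Γ Δ} χ → Complete c Γ Δ → Complete c Γ (χ ∷ Δ)
  Complete-∷ʳ {Δ = Δ} χ k {Δa = Δa} atomsΓ atomsΔ V =
    G-resp-↭ ↭-refl (↭-sym (shift χ Δa Δ))
      (complete-right χ (Complete-++ atomsΓ atomsΔ k) (Valid-resp-↭ ↭-refl (shift χ Δa Δ) V))

Complete-∷ˡ : ∀ {c Γ Δ} χ → Complete c Γ Δ → Complete c (χ ∷ Γ) Δ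
Complete-∷ˡ {Γ = Γ} χ k {Γa} atomsΓ atomsΔ V =
  G-resp-↭ (↭-sym (shift χ Γa Γ)) ↭-refl
    (complete-left χ (Complete-++ atomsΓ atomsΔ k) (Valid-resp-↭ (shift χ Γa Γ) ↭-refl V))

complete-all : ∀ {c} Γ Δ → Complete c Γ Δ
complete-all []      []      = Complete-[]
complete-all []      (χ ∷ Δ) = Complete-∷ʳ χ (complete-all [] Δ)
complete-all (χ ∷ Γ) Δ       = Complete-∷ˡ χ (complete-all Γ Δ)

complete : ∀ {c Γ Δ} → Valid Γ Δ → G c Γ Δ
complete {Γ = Γ} {Δ} = complete-all Γ Δ [] []

-- IL in G + Cut

Theorem : Fm → Set
Theorem χ = G+Cut⊢ [] [ χ ]

cut-theorems : ∀ {Γ Δ} Ks → All Theorem Ks → G true (Ks ++ Γ) Δ → G true Γ Δ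
cut-theorems          []       []       s = s
cut-theorems {Γ} {Δ} (k ∷ Ks) (t ∷ ts) s =
  cut-theorems Ks ts (cut k (G-resp-↭ ↭-refl (∷↭∷ʳ k Δ) (G-weaken (Ks ++ Γ) Δ t)) s)

valid-from-theorems : ∀ {Γ Δ Ks} → All Theorem Ks → Valid (Ks ++ Γ) Δ → G true Γ Δ
valid-from-theorems ts V = cut-theorems _ ts (complete V)

ValidPremises : ∀ {m} → Vec Fm m → Vec Fm m → Fm → Fm → Set
ValidPremises φs ψs ψ φ = ∀ i → Valid (▷prem-ant φs (ψs ∷ʳ ψ) φ i) (▷prem-suc φs (ψs ∷ʳ ψ) φ i)

▷IL-valid : ∀ {c m} (φs ψs : Vec Fm m) ψ φ →
            ValidPremises φs ψs ψ φ → G c (toList (zipWith _▷_ φs ψs)) [ ψ ▷ φ ]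
▷IL-valid φs ψs ψ φ V = ▷IL _ φs ψs ψ φ (↭-reflexive (sym (++-identityʳ _))) ↭-refl (complete ∘ V)

G-⇒R : ∀ {c a b Γ} → G c (a ∷ Γ) [ b ] → G c Γ [ a ⇒ b ]
G-⇒R {a = a} {b} = ⇒R {Δ = []} a b ↭-refl

IL⊢⇒Theorem : ∀ {χ} → IL⊢ χ → Theorem χ
IL⊢⇒Theorem (taut t) = complete λ ρ _ → here (holds (Equivalence.from T-≡ (t (varᵛ ρ) (▷ᵛ ρ))))
IL⊢⇒Theorem (mp p q) =
  valid-from-theorems (IL⊢⇒Theorem p ∷ IL⊢⇒Theorem q ∷ []) λ { ρ (i ∷ x ∷ []) → here (⊨⇒-elim i x) }
IL⊢⇒Theorem (nec {φ} p) = ▷IL 0 [] [] (¬′ φ) ⊥′ ↭-refl ↭-refl λ { zero →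
  valid-from-theorems (IL⊢⇒Theorem p ∷ []) λ { ρ (x ∷ nx ∷ _) → ⊥-elim (⊨¬-elim nx x) } }
IL⊢⇒Theorem (axK φ ψ) = G-⇒R (G-⇒R (▷IL-valid (¬′ φ ∷ ¬′ (φ ⇒ ψ) ∷ []) (⊥′ ∷ ⊥′ ∷ []) (¬′ ψ) ⊥′ V))
  where
  V : ValidPremises (¬′ φ ∷ ¬′ (φ ⇒ ψ) ∷ []) (⊥′ ∷ ⊥′ ∷ []) (¬′ ψ) ⊥′
  V zero             ρ (x ∷ _) = ⊥-elim (⊭⊥ x)
  V (suc zero)       ρ (x ∷ _) = ⊥-elim (⊭⊥ x)
  V (suc (suc zero)) ρ (nψ ∷ _) with φ ⊨?
  ... | yes x = there (here (⊨¬-intro λ i → ⊨¬-elim nψ (⊨⇒-elim i x)))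
  ... | no nx = here (⊨¬-intro nx)
IL⊢⇒Theorem (ax4 φ) = G-⇒R (▷IL-valid (¬′ φ ∷ []) (⊥′ ∷ []) (¬′ (□ φ)) ⊥′ V)
  where
  V : ValidPremises (¬′ φ ∷ []) (⊥′ ∷ []) (¬′ (□ φ)) ⊥′
  V zero       ρ (x ∷ _)            = ⊥-elim (⊭⊥ x)
  V (suc zero) ρ (n□φ ∷ _ ∷ □φ ∷ _) = ⊥-elim (⊨¬-elim n□φ □φ)
IL⊢⇒Theorem (axL φ) = G-⇒R (▷IL-valid (¬′ (□ φ ⇒ φ) ∷ []) (⊥′ ∷ []) (¬′ φ) ⊥′ V)
  where
  V : ValidPremises (¬′ (□ φ ⇒ φ) ∷ []) (⊥′ ∷ []) (¬′ φ) ⊥′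
  V zero       ρ (x ∷ _)       = ⊥-elim (⊭⊥ x)
  V (suc zero) ρ (nφ ∷ □φ ∷ _) = here (⊨¬-intro λ i → ⊨¬-elim nφ (⊨⇒-elim i □φ))
IL⊢⇒Theorem (axJ1 φ ψ) = G-⇒R (▷IL-valid (¬′ (φ ⇒ ψ) ∷ []) (⊥′ ∷ []) φ ψ V)
  where
  V : ValidPremises (¬′ (φ ⇒ ψ) ∷ []) (⊥′ ∷ []) φ ψ
  V zero       ρ (x ∷ _) = ⊥-elim (⊭⊥ x)
  V (suc zero) ρ (x ∷ _) with ψ ⊨?
  ... | yes y = there (here y)
  ... | no ny = here (⊨¬-intro λ i → ny (⊨⇒-elim i x))
IL⊢⇒Theorem (axJ2 φ χ ψ) =
  valid-from-theorems (G-⇒R (G-⇒R (▷IL-valid (χ ∷ φ ∷ []) (ψ ∷ χ ∷ []) φ ψ V)) ∷ [])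
    λ { ρ (h ∷ []) → here (⊨⇒-intro λ c → let φχ , χψ = ⊨∧-elim c in ⊨⇒-elim (⊨⇒-elim h φχ) χψ) }
  where
  V : ValidPremises (χ ∷ φ ∷ []) (ψ ∷ χ ∷ []) φ ψ
  V zero             ρ (y ∷ _) = here y
  V (suc zero)       ρ (y ∷ _) = here y
  V (suc (suc zero)) ρ (x ∷ _) = there (here x)
IL⊢⇒Theorem (axJ3 φ χ ψ) =
  valid-from-theorems (G-⇒R (G-⇒R (▷IL-valid (φ ∷ χ ∷ []) (ψ ∷ ψ ∷ []) (φ ∨′ χ) ψ V)) ∷ [])
    λ { ρ (h ∷ []) → here (⊨⇒-intro λ c → let φψ , χψ = ⊨∧-elim c in ⊨⇒-elim (⊨⇒-elim h χψ) φψ) }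
  where
  V : ValidPremises (φ ∷ χ ∷ []) (ψ ∷ ψ ∷ []) (φ ∨′ χ) ψ
  V zero             ρ (y ∷ _) = here y
  V (suc zero)       ρ (y ∷ _) = there (here y)
  V (suc (suc zero)) ρ (x∨y ∷ _) with φ ⊨?
  ... | yes x = here x
  ... | no nx = there (here (⊨⇒-elim x∨y (⊨¬-intro nx)))
IL⊢⇒Theorem (axJ4 φ ψ) =
  valid-from-theorems (G-⇒R (G-⇒R (▷IL-valid (ψ ∷ φ ∷ []) (⊥′ ∷ ψ ∷ []) φ ⊥′ V)) ∷ [])
    λ { ρ (h ∷ []) → here (⊨⇒-intro λ φψ → ⊨⇒-intro λ ◇φ → ⊨¬-intro λ ψ⊥ →
                             ⊨¬-elim ◇φ (⊨⇒-elim (⊨⇒-elim h φψ) ψ⊥)) }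
  where
  V : ValidPremises (ψ ∷ φ ∷ []) (⊥′ ∷ ψ ∷ []) φ ⊥′
  V zero             ρ (x ∷ _) = ⊥-elim (⊭⊥ x)
  V (suc zero)       ρ (y ∷ _) = here y
  V (suc (suc zero)) ρ (x ∷ _) = there (here x)
IL⊢⇒Theorem (axJ5 φ) = ▷IL-valid [] [] (◇ φ) φ V
  where
  V : ValidPremises [] [] (◇ φ) φ
  V zero ρ (◇φ ∷ _ ∷ φ⊥ ∷ _) = ⊥-elim (⊨¬-elim ◇φ φ⊥)

mainTheorem3 : ∀ (Γ Δ : List Fm) →
    (IL⊢ (⋀ Γ ⇒ ⋁ Δ) → G+Cut⊢ Γ Δ) × (G+Cut⊢ Γ Δ → IL⊢ (⋀ Γ ⇒ ⋁ Δ))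
mainTheorem3 Γ Δ = completeness , sound
  where
  completeness : IL⊢ (⋀ Γ ⇒ ⋁ Δ) → G+Cut⊢ Γ Δ
  completeness p = valid-from-theorems (IL⊢⇒Theorem p ∷ []) λ { ρ (h ∷ γ) → ⊨⋀⇒⋁-elim h γ }
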